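{- For all nonnegative integers $n$ and $k$ and every positive integer $r$, $$ \binom{k+r-1}{k}_q H_n^{(k+r)}(q)=\binom{n+k}{n}_q H_{n+k}^{(r)}(q)-\binom{n+k+r-1}{n}_q H_k^{(r)}(q)\,. $$
   Context: $q$ is a parameter (e.g. an indeterminate, or a nonzero complex number) for which all quantities below are defined. $[n]_q=\frac{1-q^n}{1-q}=1+q+\dots+q^{n-1}$, $[n]_q!=[n]_q[n-1]_q\cdots[1]_q$ with $[0]_q!=1$, and $\binom{n}{k}_q=\frac{[n]_q!}{[k]_q![n-k]_q!}$ for $0\le k\le n$. The $q$-hyperharmonic numbers are defined by $H_n^{(0)}(q)=\frac{1}{q[n]_q}$ for $n\ge1$ and $H_n^{(r)}(q)=\sum_{j=1}^n q^jH_j^{(r-1)}(q)$ for $r,n\ge1$; in particular $H_0^{(r)}(q)=0$ (empty sum) for $r\ge1$. -}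

module Defs where

open import Level using (Level)
open import Data.Nat using (ℕ; zero; suc; _∸_; _≤_)
open import Algebra.Bundles using (CommutativeRing)

-- The hypothesis "all quantities are defined" is
-- encoded by a family inv : ℕ → R with  q·[m]_q·inv m = 1  for every m ≥ 1.
module _ {c ℓ : Level} (R : CommutativeRing c ℓ) where
  open CommutativeRing R

  pow : Carrier → ℕ → Carrier
  pow x zero    = 1#
  pow x (suc n) = x * pow x n

  qint : Carrier → ℕ → Carrier
  qint q zero    = 0#
  qint q (suc n) = qint q n + pow q n

  qfact : Carrier → ℕ → Carrier
  qfact q zero    = 1#
  qfact q (suc n) = qint q (suc n) * qfact q n

  QInverse : Carrier → (ℕ → Carrier) → Set ℓ
  QInverse q inv = ∀ (m : ℕ) → 1 ≤ m → (q * qint q m) * inv m ≈ 1#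

  qintInv : Carrier → (ℕ → Carrier) → ℕ → Carrier
  qintInv q inv m = q * inv m

  qfactInv : Carrier → (ℕ → Carrier) → ℕ → Carrier
  qfactInv q inv zero    = 1#
  qfactInv q inv (suc n) = qintInv q inv (suc n) * qfactInv q inv n

  -- q-binomial  [n]_q! / ([k]_q! [n-k]_q!)   (only used for 0 ≤ k ≤ n)
  qbinom : Carrier → (ℕ → Carrier) → ℕ → ℕ → Carrier
  qbinom q inv n k = qfact q n * (qfactInv q inv k * qfactInv q inv (n ∸ k))

  -- q-hyperharmonic numbers  H q inv n r = H_n^{(r)}(q)
  -- H_n^{(0)} = 1/(q[n]_q) (n ≥ 1), H_n^{(r)} = Σ_{j=1}^n q^j H_j^{(r-1)}
  H : Carrier → (ℕ → Carrier) → ℕ → ℕ → Carrier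
  H q inv n       zero    = inv n
  H q inv zero    (suc r) = 0#
  H q inv (suc n) (suc r) = H q inv n (suc r) + pow q (suc n) * H q inv (suc n) r

{-# OPTIONS --safe #-}
-- Write h m = H_m^(1). A double induction driven by the q-Pascal rule gives the closed form
--   H_n^(k+1) = [n+k choose n]_q · (h (n+k) − h k).
-- For r = s+1, substituting it for the three hyperharmonic numbers of the identity turns all
-- three coefficients into the q-trinomial [n+k+s]_q! / ([n]_q! [k]_q! [s]_q!), and what remains
-- is (a − e) = (a − t) − (e − t) for the harmonic numbers a, e, t at n+k+s, k+s and s.
module Submission where

open import Defs
open import Level using (Level)
open import Data.Nat using (ℕ; _≤_; zero; suc; s≤s; z≤n) renaming (_+_ to _+ℕ_; _∸_ to _∸ℕ_)
import Data.Nat.Properties as ℕₚ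
open import Algebra.Bundles using (CommutativeSemiring; CommutativeRing)
open import Relation.Binary.PropositionalEquality as ≡ using (_≡_)

module SemiringLemmas {c ℓ : Level} (S : CommutativeSemiring c ℓ) where
  open CommutativeSemiring S
  open import Algebra.Solver.Ring.NaturalCoefficients.Default S
  open import Relation.Binary.Reasoning.Setoid setoid

  scaled : ∀ {a a′ t x u v} → a * a′ ≈ t → x + a′ * u ≈ a′ * v → a * x + t * u ≈ t * v
  scaled {a} {a′} {t} {x} {u} {v} aa′≈t eq = begin
    a * x + t * u       ≈⟨ +-congˡ (*-congʳ (sym aa′≈t)) ⟩
    a * x + a * a′ * u  ≈⟨ solve 4 (λ a a′ x u → a :* x :+ a :* a′ :* u := a :* (x :+ a′ :* u))
                                   refl a a′ x u ⟩
    a * (x + a′ * u)    ≈⟨ *-congˡ eq ⟩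
    a * (a′ * v)        ≈⟨ sym (*-assoc a a′ v) ⟩
    a * a′ * v          ≈⟨ *-congʳ aa′≈t ⟩
    t * v               ∎

  x≈1⇒x*y≈y : ∀ {x} y → x ≈ 1# → x * y ≈ y
  x≈1⇒x*y≈y y x≈1 = trans (*-congʳ x≈1) (*-identityˡ y)

  -- b₁₁ = b₀₁ + p b₁₀ is a q-Pascal rule; d + δ and A + ε are the harmonic numbers following d and A.
  pascal-induction-step : ∀ {x y b₁₁ b₀₁ b₁₀ p A d δ ε} →
                          b₁₁ ≈ b₀₁ + p * b₁₀ → b₁₁ * ε ≈ p * b₁₀ * δ →
                          x + b₀₁ * (d + δ) ≈ b₀₁ * A → y + b₁₀ * d ≈ b₁₀ * A →
                          x + p * y + b₁₁ * (d + δ) ≈ b₁₁ * (A + ε)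
  pascal-induction-step {x} {y} {b₁₁} {b₀₁} {b₁₀} {p} {A} {d} {δ} {ε} pascal edge eq₀₁ eq₁₀ = begin
    x + p * y + b₁₁ * (d + δ)
      ≈⟨ +-congˡ (*-congʳ pascal) ⟩
    x + p * y + (b₀₁ + p * b₁₀) * (d + δ)
      ≈⟨ solve 7 (λ x y b₀₁ b₁₀ p d δ → x :+ p :* y :+ (b₀₁ :+ p :* b₁₀) :* (d :+ δ)
                  := (x :+ b₀₁ :* (d :+ δ)) :+ p :* (y :+ b₁₀ :* d) :+ p :* b₁₀ :* δ)
                 refl x y b₀₁ b₁₀ p d δ ⟩
    (x + b₀₁ * (d + δ)) + p * (y + b₁₀ * d) + p * b₁₀ * δ
      ≈⟨ +-cong (+-cong eq₀₁ (*-congˡ eq₁₀)) (sym edge) ⟩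
    b₀₁ * A + p * (b₁₀ * A) + b₁₁ * ε
      ≈⟨ +-congʳ (solve 4 (λ b₀₁ b₁₀ p A → b₀₁ :* A :+ p :* (b₁₀ :* A) := (b₀₁ :+ p :* b₁₀) :* A)
                          refl b₀₁ b₁₀ p A) ⟩
    (b₀₁ + p * b₁₀) * A + b₁₁ * ε
      ≈⟨ +-congʳ (*-congʳ (sym pascal)) ⟩
    b₁₁ * A + b₁₁ * ε
      ≈⟨ sym (distribˡ b₁₁ A ε) ⟩
    b₁₁ * (A + ε)
      ∎

module RingLemmas {c ℓ : Level} (R : CommutativeRing c ℓ) where
  open CommutativeRing R
  open import Relation.Binary.Reasoning.Setoid setoid
  open import Algebra.Properties.Group +-group using (x≈z//y; ∙-cancelʳ)

  telescope : ∀ {a b d x y z} → a + y ≈ x → b + z ≈ x → d + z ≈ y → a ≈ b - d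
  telescope {a} {b} {d} {x} {y} {z} a+y≈x b+z≈x d+z≈y = x≈z//y a d b (∙-cancelʳ z (a + d) b (begin
    a + d + z    ≈⟨ +-assoc a d z ⟩
    a + (d + z)  ≈⟨ +-congˡ d+z≈y ⟩
    a + y        ≈⟨ a+y≈x ⟩
    x            ≈⟨ sym b+z≈x ⟩
    b + z        ∎))

module QAnalogues {c ℓ : Level} (R : CommutativeRing c ℓ) (q : CommutativeRing.Carrier R) where
  open CommutativeRing R
  open import Algebra.Solver.Ring.NaturalCoefficients.Default commutativeSemiring
  open import Relation.Binary.Reasoning.Setoid setoid

  q^_ : ℕ → Carrier
  q^ n = pow R q n

  [_] : ℕ → Carrier
  [ n ] = qint R q n

  [_]! : ℕ → Carrier
  [ n ]! = qfact R q n

  q^-+ : ∀ a b → q^ (a +ℕ b) ≈ q^ a * q^ b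
  q^-+ zero    b = sym (*-identityˡ (q^ b))
  q^-+ (suc a) b = trans (*-congˡ (q^-+ a b)) (sym (*-assoc q (q^ a) (q^ b)))

  []-+ : ∀ a b → [ a +ℕ b ] ≈ [ a ] + q^ a * [ b ]
  []-+ a zero = begin
    [ a +ℕ 0 ]        ≡⟨ ≡.cong [_] (ℕₚ.+-identityʳ a) ⟩
    [ a ]             ≈⟨ sym (+-identityʳ [ a ]) ⟩
    [ a ] + 0#        ≈⟨ +-congˡ (sym (zeroʳ (q^ a))) ⟩
    [ a ] + q^ a * 0# ∎
  []-+ a (suc b) = begin
    [ a +ℕ suc b ]                      ≡⟨ ≡.cong [_] (ℕₚ.+-suc a b) ⟩
    [ a +ℕ b ] + q^ (a +ℕ b)            ≈⟨ +-cong ([]-+ a b) (q^-+ a b) ⟩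
    [ a ] + q^ a * [ b ] + q^ a * q^ b  ≈⟨ solve 4 (λ x y z w → x :+ y :* z :+ y :* w := x :+ y :* (z :+ w))
                                                 refl [ a ] (q^ a) [ b ] (q^ b) ⟩
    [ a ] + q^ a * [ suc b ]            ∎

  module Invertible (inv : ℕ → Carrier) (invertible : QInverse R q inv) where
    open SemiringLemmas commutativeSemiring using (x≈1⇒x*y≈y; pascal-induction-step)

    [_]⁻¹ : ℕ → Carrier
    [ n ]⁻¹ = qintInv R q inv n

    [_]!⁻¹ : ℕ → Carrier
    [ n ]!⁻¹ = qfactInv R q inv n

    []-inverse : ∀ m → [ suc m ] * [ suc m ]⁻¹ ≈ 1#
    []-inverse m = trans (solve 3 (λ x q i → x :* (q :* i) := q :* x :* i) refl [ suc m ] q (inv (suc m)))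
                         (invertible (suc m) (s≤s z≤n))

    []!-inverse : ∀ m → [ m ]! * [ m ]!⁻¹ ≈ 1#
    []!-inverse zero    = *-identityˡ 1#
    []!-inverse (suc m) = begin
      [ suc m ] * [ m ]! * ([ suc m ]⁻¹ * [ m ]!⁻¹)
        ≈⟨ solve 4 (λ x f y g → x :* f :* (y :* g) := x :* y :* (f :* g))
                   refl [ suc m ] [ m ]! [ suc m ]⁻¹ [ m ]!⁻¹ ⟩
      [ suc m ] * [ suc m ]⁻¹ * ([ m ]! * [ m ]!⁻¹)
        ≈⟨ *-cong ([]-inverse m) ([]!-inverse m) ⟩
      1# * 1#
        ≈⟨ *-identityˡ 1# ⟩
      1# ∎

    []-*-[]!⁻¹ : ∀ m → [ suc m ] * [ suc m ]!⁻¹ ≈ [ m ]!⁻¹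
    []-*-[]!⁻¹ m = trans (sym (*-assoc [ suc m ] [ suc m ]⁻¹ [ m ]!⁻¹)) (x≈1⇒x*y≈y [ m ]!⁻¹ ([]-inverse m))

    binomial : ℕ → ℕ → Carrier
    binomial a b = [ a +ℕ b ]! * ([ a ]!⁻¹ * [ b ]!⁻¹)

    qbinom≡binomial : ∀ a b → qbinom R q inv (a +ℕ b) a ≡ binomial a b
    qbinom≡binomial a b = ≡.cong (λ j → [ a +ℕ b ]! * ([ a ]!⁻¹ * [ j ]!⁻¹)) (ℕₚ.m+n∸m≡n a b)

    binomial-zeroʳ : ∀ a → binomial a 0 ≈ 1#
    binomial-zeroʳ a = begin
      [ a +ℕ 0 ]! * ([ a ]!⁻¹ * 1#) ≡⟨ ≡.cong (λ j → [ j ]! * ([ a ]!⁻¹ * 1#)) (ℕₚ.+-identityʳ a) ⟩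
      [ a ]! * ([ a ]!⁻¹ * 1#)      ≈⟨ *-congˡ (*-identityʳ [ a ]!⁻¹) ⟩
      [ a ]! * [ a ]!⁻¹             ≈⟨ []!-inverse a ⟩
      1#                            ∎

    binomial-pascal : ∀ a b → binomial (suc a) (suc b) ≈ binomial a (suc b) + q^ suc a * binomial (suc a) b
    binomial-pascal a b = begin
      [ suc a +ℕ suc b ] * [ m ]! * ([ suc a ]!⁻¹ * [ suc b ]!⁻¹)
        ≈⟨ *-congʳ (*-congʳ ([]-+ (suc a) (suc b))) ⟩
      ([ suc a ] + q^ suc a * [ suc b ]) * [ m ]! * ([ suc a ]!⁻¹ * [ suc b ]!⁻¹)
        ≈⟨ solve 6 (λ x p y f g h → (x :+ p :* y) :* f :* (g :* h)
                                    := f :* (x :* g :* h) :+ p :* (f :* (g :* (y :* h))))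
                   refl [ suc a ] (q^ suc a) [ suc b ] [ m ]! [ suc a ]!⁻¹ [ suc b ]!⁻¹ ⟩
      [ m ]! * ([ suc a ] * [ suc a ]!⁻¹ * [ suc b ]!⁻¹)
        + q^ suc a * ([ m ]! * ([ suc a ]!⁻¹ * ([ suc b ] * [ suc b ]!⁻¹)))
        ≈⟨ +-cong (*-congˡ (*-congʳ ([]-*-[]!⁻¹ a))) (*-congˡ (*-congˡ (*-congˡ ([]-*-[]!⁻¹ b)))) ⟩
      [ m ]! * ([ a ]!⁻¹ * [ suc b ]!⁻¹) + q^ suc a * ([ m ]! * ([ suc a ]!⁻¹ * [ b ]!⁻¹))
        ≡⟨ ≡.cong (λ j → binomial a (suc b) + q^ suc a * ([ j ]! * ([ suc a ]!⁻¹ * [ b ]!⁻¹)))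
                  (ℕₚ.+-suc a b) ⟩
      binomial a (suc b) + q^ suc a * binomial (suc a) b
        ∎
      where m = a +ℕ suc b

    binomial-absorb : ∀ a b → binomial (suc a) (suc b) * [ suc (suc (a +ℕ b)) ]⁻¹
                            ≈ binomial (suc a) b * [ suc b ]⁻¹
    binomial-absorb a b = begin
      [ suc (a +ℕ suc b) ]! * ([ suc a ]!⁻¹ * [ suc b ]!⁻¹) * [ suc m ]⁻¹
        ≡⟨ ≡.cong (λ j → [ suc j ]! * ([ suc a ]!⁻¹ * [ suc b ]!⁻¹) * [ suc m ]⁻¹) (ℕₚ.+-suc a b) ⟩
      [ suc m ] * [ m ]! * ([ suc a ]!⁻¹ * [ suc b ]!⁻¹) * [ suc m ]⁻¹
        ≈⟨ solve 5 (λ x f g h y → x :* f :* (g :* h) :* y := x :* y :* (f :* (g :* h)))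
                   refl [ suc m ] [ m ]! [ suc a ]!⁻¹ [ suc b ]!⁻¹ [ suc m ]⁻¹ ⟩
      [ suc m ] * [ suc m ]⁻¹ * ([ m ]! * ([ suc a ]!⁻¹ * ([ suc b ]⁻¹ * [ b ]!⁻¹)))
        ≈⟨ x≈1⇒x*y≈y _ ([]-inverse m) ⟩
      [ m ]! * ([ suc a ]!⁻¹ * ([ suc b ]⁻¹ * [ b ]!⁻¹))
        ≈⟨ solve 4 (λ f g y h → f :* (g :* (y :* h)) := f :* (g :* h) :* y)
                   refl [ m ]! [ suc a ]!⁻¹ [ suc b ]⁻¹ [ b ]!⁻¹ ⟩
      binomial (suc a) b * [ suc b ]⁻¹
        ∎
      where m = suc (a +ℕ b)

    trinomial : ℕ → ℕ → ℕ → Carrier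
    trinomial a b c = [ a +ℕ b +ℕ c ]! * ([ a ]!⁻¹ * [ b ]!⁻¹ * [ c ]!⁻¹)

    binomial*binomial≈trinomial : ∀ a b c → binomial a b * binomial (a +ℕ b) c ≈ trinomial a b c
    binomial*binomial≈trinomial a b c = begin
      [ a +ℕ b ]! * ([ a ]!⁻¹ * [ b ]!⁻¹) * ([ a +ℕ b +ℕ c ]! * ([ a +ℕ b ]!⁻¹ * [ c ]!⁻¹))
        ≈⟨ solve 6 (λ f x y n g z → f :* (x :* y) :* (n :* (g :* z)) := f :* g :* (n :* (x :* y :* z)))
                   refl [ a +ℕ b ]! [ a ]!⁻¹ [ b ]!⁻¹ [ a +ℕ b +ℕ c ]! [ a +ℕ b ]!⁻¹ [ c ]!⁻¹ ⟩
      [ a +ℕ b ]! * [ a +ℕ b ]!⁻¹ * trinomial a b c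
        ≈⟨ x≈1⇒x*y≈y _ ([]!-inverse (a +ℕ b)) ⟩
      trinomial a b c
        ∎

    binomial*binomial≈trinomial′ : ∀ a b c → binomial b c * binomial a (b +ℕ c) ≈ trinomial a b c
    binomial*binomial≈trinomial′ a b c = begin
      [ b +ℕ c ]! * ([ b ]!⁻¹ * [ c ]!⁻¹) * ([ a +ℕ (b +ℕ c) ]! * ([ a ]!⁻¹ * [ b +ℕ c ]!⁻¹))
        ≈⟨ solve 6 (λ f y z n x g → f :* (y :* z) :* (n :* (x :* g)) := f :* g :* (n :* (x :* y :* z)))
                   refl [ b +ℕ c ]! [ b ]!⁻¹ [ c ]!⁻¹ [ a +ℕ (b +ℕ c) ]! [ a ]!⁻¹ [ b +ℕ c ]!⁻¹ ⟩
      [ b +ℕ c ]! * [ b +ℕ c ]!⁻¹ * ([ a +ℕ (b +ℕ c) ]! * ([ a ]!⁻¹ * [ b ]!⁻¹ * [ c ]!⁻¹))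
        ≈⟨ x≈1⇒x*y≈y _ ([]!-inverse (b +ℕ c)) ⟩
      [ a +ℕ (b +ℕ c) ]! * ([ a ]!⁻¹ * [ b ]!⁻¹ * [ c ]!⁻¹)
        ≡⟨ ≡.cong (λ j → [ j ]! * ([ a ]!⁻¹ * [ b ]!⁻¹ * [ c ]!⁻¹)) (≡.sym (ℕₚ.+-assoc a b c)) ⟩
      trinomial a b c
        ∎

    h : ℕ → Carrier
    h m = H R q inv m 1

    -- h (suc m) = h m + Δh (suc m) holds by definition of H.
    Δh : ℕ → Carrier
    Δh m = q^ m * inv m

    binomial-*-Δh : ∀ a b → binomial (suc a) (suc b) * Δh (suc (suc (a +ℕ b)))
                          ≈ q^ suc a * binomial (suc a) b * Δh (suc b)
    binomial-*-Δh a b = begin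
      binomial (suc a) (suc b) * (q * q^ suc (a +ℕ b) * inv (suc (suc (a +ℕ b))))
        ≈⟨ solve 4 (λ x q p i → x :* (q :* p :* i) := x :* (q :* i) :* p)
                   refl (binomial (suc a) (suc b)) q (q^ suc (a +ℕ b)) (inv (suc (suc (a +ℕ b)))) ⟩
      binomial (suc a) (suc b) * [ suc (suc (a +ℕ b)) ]⁻¹ * q^ (suc a +ℕ b)
        ≈⟨ *-cong (binomial-absorb a b) (q^-+ (suc a) b) ⟩
      binomial (suc a) b * (q * inv (suc b)) * (q^ suc a * q^ b)
        ≈⟨ solve 5 (λ x q i p r → x :* (q :* i) :* (p :* r) := p :* x :* (q :* r :* i))
                   refl (binomial (suc a) b) q (inv (suc b)) (q^ suc a) (q^ b) ⟩
      q^ suc a * binomial (suc a) b * (q^ suc b * inv (suc b))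
        ∎

    -- With h k on the left, the induction needs no subtraction.
    hyperharmonic-closedForm : ∀ k n → H R q inv n (suc k) + binomial n k * h k ≈ binomial n k * h (n +ℕ k)
    hyperharmonic-closedForm k       zero    = +-identityˡ _
    hyperharmonic-closedForm zero    n       = begin
      h n + binomial n 0 * 0#   ≈⟨ +-congˡ (zeroʳ (binomial n 0)) ⟩
      h n + 0#                  ≈⟨ +-identityʳ (h n) ⟩
      h n                       ≈⟨ sym (x≈1⇒x*y≈y (h n) (binomial-zeroʳ n)) ⟩
      binomial n 0 * h n        ≡⟨ ≡.cong (λ j → binomial n 0 * h j) (≡.sym (ℕₚ.+-identityʳ n)) ⟩
      binomial n 0 * h (n +ℕ 0) ∎
    hyperharmonic-closedForm (suc k) (suc n) = begin
      H R q inv (suc n) (suc (suc k)) + binomial (suc n) (suc k) * h (suc k)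
        ≈⟨ pascal-induction-step (binomial-pascal n k) (binomial-*-Δh n k)
                                 shifted (hyperharmonic-closedForm k (suc n)) ⟩
      binomial (suc n) (suc k) * h (suc (suc (n +ℕ k)))
        ≡⟨ ≡.cong (λ j → binomial (suc n) (suc k) * h (suc j)) (≡.sym (ℕₚ.+-suc n k)) ⟩
      binomial (suc n) (suc k) * h (suc n +ℕ suc k)
        ∎
      where
      shifted : H R q inv n (suc (suc k)) + binomial n (suc k) * h (suc k) ≈ binomial n (suc k) * h (suc (n +ℕ k))
      shifted = trans (hyperharmonic-closedForm (suc k) n)
                      (reflexive (≡.cong (λ j → binomial n (suc k) * h j) (ℕₚ.+-suc n k)))

theorem1 : ∀ {c ℓ : Level} (R : CommutativeRing c ℓ) (q : CommutativeRing.Carrier R)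
             (inv : ℕ → CommutativeRing.Carrier R) → QInverse R q inv →
             ∀ (n k r : ℕ) → 1 ≤ r →
             let open CommutativeRing R in
             qbinom R q inv (k +ℕ r ∸ℕ 1) k * H R q inv n (k +ℕ r)
               ≈ qbinom R q inv (n +ℕ k) n * H R q inv (n +ℕ k) r
                 - qbinom R q inv (n +ℕ k +ℕ r ∸ℕ 1) n * H R q inv k r
theorem1 R q inv invertible n k (suc s) _
  rewrite ℕₚ.+-suc k s | ℕₚ.+-suc (n +ℕ k) s | ℕₚ.+-assoc n k s =
  telescope
    (scaled (trans (*-congʳ (reflexive (qbinom≡binomial k s))) (binomial*binomial≈trinomial′ n k s))
            (hyperharmonic-closedForm (k +ℕ s) n))
    (trans (scaled (trans (*-congʳ (reflexive (qbinom≡binomial n k))) (binomial*binomial≈trinomial n k s))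
                   (hyperharmonic-closedForm s (n +ℕ k)))
           (*-congˡ (reflexive (≡.cong h (ℕₚ.+-assoc n k s)))))
    (scaled (trans (*-congʳ (reflexive (qbinom≡binomial n (k +ℕ s))))
                   (trans (*-comm (binomial n (k +ℕ s)) (binomial k s)) (binomial*binomial≈trinomial′ n k s)))
            (hyperharmonic-closedForm s k))
  where
  open CommutativeRing R
  open SemiringLemmas commutativeSemiring using (scaled)
  open RingLemmas R using (telescope)
  open QAnalogues.Invertible R q inv invertible
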